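{- In the logic $\operatorname{SŁ}^1_\omega$, the relation $\sim_{\blacktriangleleft}$ on formulas defined by $\alpha\sim_{\blacktriangleleft}\beta$ iff $\vdash\alpha\to\beta$ and $\vdash\beta\to\alpha$ is an equivalence relation, and if $\alpha\sim_{\blacktriangleleft}\beta$ then $(\alpha\blacktriangleleft\gamma)\sim_{\blacktriangleleft}(\beta\blacktriangleleft\gamma)$ for every formula $\gamma$.
   Context: Formulas of $\operatorname{SŁ}^1_\omega$: the single variable $v$ is a formula; if $\alpha,\beta$ are formulas, so are $\neg\alpha$, $\alpha\to\beta$ and $\alpha\blacktriangleleft\beta$. Axioms (for all formulas $\varphi,\psi,\chi,\gamma$): Ax1 $\varphi\to(\psi\to\varphi)$; Ax2 $(\varphi\to\psi)\to((\psi\to\chi)\to(\varphi\to\chi))$; Ax3 $((\varphi\to\psi)\to\psi)\to((\psi\to\varphi)\to\varphi)$; Ax4 $(\neg\varphi\to\neg\psi)\to(\psi\to\varphi)$; Ax5 $(\varphi\blacktriangleleft v)\to\varphi$; Ax6 $(v\blacktriangleleft\varphi)\to\varphi$; Ax7 $\varphi\to(v\blacktriangleleft\varphi)$; Ax8 $\varphi\to(\varphi\blacktriangleleft v)$; Ax9 $((\varphi\to\psi)\blacktriangleleft\gamma)\to((\varphi\blacktriangleleft\gamma)\to(\psi\blacktriangleleft\gamma))$; Ax10 $((\neg\varphi\to\psi)\blacktriangleleft\gamma)\to(\neg(\varphi\blacktriangleleft\gamma)\to(\psi\blacktriangleleft\gamma))$; Ax11 $(\neg(\varphi\blacktriangleleft\gamma)\to(\psi\blacktriangleleft\gamma))\to((\neg\varphi\to\psi)\blacktriangleleft\gamma)$;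 Ax12 $(\varphi\blacktriangleleft(\psi\blacktriangleleft\gamma))\to((\varphi\blacktriangleleft\psi)\blacktriangleleft\gamma)$; Ax13 $((\varphi\blacktriangleleft\psi)\blacktriangleleft\gamma)\to(\varphi\blacktriangleleft(\psi\blacktriangleleft\gamma))$; Ax14 $\neg(\varphi\blacktriangleleft\psi)\to(\neg\varphi\blacktriangleleft\psi)$; Ax15 $(\neg\varphi\blacktriangleleft\psi)\to\neg(\varphi\blacktriangleleft\psi)$. Inference rules: Modus Ponens (from $\alpha$ and $\alpha\to\beta$ infer $\beta$); $\blacktriangleleft$-rule (from $\alpha$ infer $\alpha\blacktriangleleft\beta$, for any $\beta$); Arrow $\blacktriangleleft$-rule (from $\alpha$ infer $\alpha\to(\alpha\blacktriangleleft\beta)$, for any $\beta$). $\vdash\alpha$ means $\alpha$ is derivable from the axioms by the rules. -}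

module Defs where

open import Data.Product using (_×_)

infixr 6 _⇒_
infixl 7 _◀_
data Formula : Set where
  v   : Formula
  ¬′_ : Formula → Formula
  _⇒_ : Formula → Formula → Formula
  _◀_ : Formula → Formula → Formula

data ⊢_ : Formula → Set where
  ax1  : ∀ φ ψ → ⊢ (φ ⇒ (ψ ⇒ φ))
  ax2  : ∀ φ ψ χ → ⊢ ((φ ⇒ ψ) ⇒ ((ψ ⇒ χ) ⇒ (φ ⇒ χ)))
  ax3  : ∀ φ ψ → ⊢ (((φ ⇒ ψ) ⇒ ψ) ⇒ ((ψ ⇒ φ) ⇒ φ))
  ax4  : ∀ φ ψ → ⊢ ((¬′ φ ⇒ ¬′ ψ) ⇒ (ψ ⇒ φ))
  ax5  : ∀ φ → ⊢ ((φ ◀ v) ⇒ φ)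
  ax6  : ∀ φ → ⊢ ((v ◀ φ) ⇒ φ)
  ax7  : ∀ φ → ⊢ (φ ⇒ (v ◀ φ))
  ax8  : ∀ φ → ⊢ (φ ⇒ (φ ◀ v))
  ax9  : ∀ φ ψ γ → ⊢ (((φ ⇒ ψ) ◀ γ) ⇒ ((φ ◀ γ) ⇒ (ψ ◀ γ)))
  ax10 : ∀ φ ψ γ → ⊢ (((¬′ φ ⇒ ψ) ◀ γ) ⇒ (¬′ (φ ◀ γ) ⇒ (ψ ◀ γ)))
  ax11 : ∀ φ ψ γ → ⊢ ((¬′ (φ ◀ γ) ⇒ (ψ ◀ γ)) ⇒ ((¬′ φ ⇒ ψ) ◀ γ))
  ax12 : ∀ φ ψ γ → ⊢ ((φ ◀ (ψ ◀ γ)) ⇒ ((φ ◀ ψ) ◀ γ))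
  ax13 : ∀ φ ψ γ → ⊢ (((φ ◀ ψ) ◀ γ) ⇒ (φ ◀ (ψ ◀ γ)))
  ax14 : ∀ φ ψ → ⊢ (¬′ (φ ◀ ψ) ⇒ (¬′ φ ◀ ψ))
  ax15 : ∀ φ ψ → ⊢ ((¬′ φ ◀ ψ) ⇒ ¬′ (φ ◀ ψ))
  mp      : ∀ {α β} → ⊢ α → ⊢ (α ⇒ β) → ⊢ β
  ◀-rule  : ∀ {α} β → ⊢ α → ⊢ (α ◀ β)
  ⇒◀-rule : ∀ {α} β → ⊢ α → ⊢ (α ⇒ (α ◀ β))

_∼◀_ : Formula → Formula → Set
α ∼◀ β = (⊢ (α ⇒ β)) × (⊢ (β ⇒ α))

module Submission where

-- Everything reduces to three derived rules of the calculus: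
--   * hypothetical syllogism  (from ⊢ α ⇒ β and ⊢ β ⇒ χ infer ⊢ α ⇒ χ),
--     obtained from Ax2 by two applications of modus ponens;
--   * self-implication  ⊢ α ⇒ α,  the composite of Ax8 (α ⇒ α ◀ v) and
--     Ax5 (α ◀ v ⇒ α) by syllogism;
--   * monotonicity of ◀ in its left argument  (from ⊢ α ⇒ β infer
--     ⊢ α ◀ γ ⇒ β ◀ γ),  obtained by applying the ◀-rule to the premise
--     and distributing with Ax9.
-- Reflexivity, symmetry and transitivity of ∼◀ then follow componentwise,
-- and the congruence property is monotonicity applied in both directions.

open import Defs
open import Data.Product using (_×_; _,_)
open import Relation.Binary.Structures using (IsEquivalence)

⇒-trans : ∀ {α β χ} → ⊢ (α ⇒ β) → ⊢ (β ⇒ χ) → ⊢ (α ⇒ χ)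
⇒-trans {α} {β} {χ} α⇒β β⇒χ = mp β⇒χ (mp α⇒β (ax2 α β χ))

⇒-refl : ∀ α → ⊢ (α ⇒ α)
⇒-refl α = ⇒-trans (ax8 α) (ax5 α)

◀-monoˡ : ∀ {α β} γ → ⊢ (α ⇒ β) → ⊢ ((α ◀ γ) ⇒ (β ◀ γ))
◀-monoˡ {α} {β} γ α⇒β = mp (◀-rule γ α⇒β) (ax9 α β γ)

∼◀-isEquivalence : IsEquivalence _∼◀_
∼◀-isEquivalence = record
  { refl  = λ {α} → ⇒-refl α , ⇒-refl α
  ; sym   = λ { (α⇒β , β⇒α) → β⇒α , α⇒β }
  ; trans = λ { (α⇒β , β⇒α) (β⇒χ , χ⇒β) → ⇒-trans α⇒β β⇒χ , ⇒-trans χ⇒β β⇒α }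
  }

∼◀-◀-congˡ : ∀ α β γ → α ∼◀ β → (α ◀ γ) ∼◀ (β ◀ γ)
∼◀-◀-congˡ α β γ (α⇒β , β⇒α) = ◀-monoˡ γ α⇒β , ◀-monoˡ γ β⇒α

mainTheorem15 : IsEquivalence _∼◀_ × (∀ α β γ → α ∼◀ β → (α ◀ γ) ∼◀ (β ◀ γ))
mainTheorem15 = ∼◀-isEquivalence , ∼◀-◀-congˡ
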